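{- Let $G$ be a strictly chordal graph. Then every boundary clique of $G$ contains exactly one minimal vertex separator of $G$.
   Context: All graphs are finite and simple. A block graph is a connected graph in which every block (maximal biconnected subgraph) is a clique. Two vertices $u,v$ are true twins if $N[u]=N[v]$, where $N[v]=N(v)\cup\{v\}$ is the closed neighborhood. A strictly chordal graph (block duplicate graph) is a graph obtained from a block graph by adding zero or more true twins to its vertices (i.e. replacing each vertex by a set of pairwise true twin vertices). A vertex is simplicial if its neighborhood is a clique. A simplicial clique is a maximal clique containing at least one simplicial vertex; a simplicial clique $Q$ is a boundary clique if there exists a maximal clique $Q'$ such that $Q\cap Q'$ is exactly the set of non-simplicial vertices of $Q$. For non-adjacent vertices $u,v$, a set $S\subset V$ is a $uv$-separator if $u$ and $v$ lie in different connected components of $G-S$; it is a minimal $uv$-separator if no proper subset is a $uv$-separator. A minimal vertex separator is a set that is a minimal $uv$-separator for some pair of non-adjacent vertices $u,v$. -}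

module Defs where

open import Data.Nat using (ℕ)
open import Data.Fin using (Fin)
open import Data.Fin.Subset using (Subset; _∈_; _∉_; _⊆_; _⊂_; ∁; _∩_; _-_)
open import Data.Product using (Σ; ∃; ∃-syntax; _×_; _,_)
open import Data.Empty using (⊥)
open import Relation.Nullary using (¬_)
open import Relation.Binary.PropositionalEquality using (_≡_; _≢_)

record Graph (n : ℕ) : Set₁ where
  field
    _~_   : Fin n → Fin n → Set
    sym   : ∀ {x y} → x ~ y → y ~ x
    irrefl : ∀ {x} → ¬ (x ~ x)
open Graph public

module _ {n : ℕ} (G : Graph n) where
  open Graph G using () renaming (_~_ to _∼_)

  data PathIn (S : Subset n) : Fin n → Fin n → Set where
    here : ∀ {u} → u ∈ S → PathIn S u u
    step : ∀ {u v w} → u ∈ S → u ∼ v → PathIn S v w → PathIn S u w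

  ConnectedIn : Subset n → Set
  ConnectedIn S = ∀ u v → u ∈ S → v ∈ S → PathIn S u v

  Connected : Set
  Connected = ∀ (u v : Fin n) → PathIn (Data.Fin.Subset.⊤) u v

  IsClique : Subset n → Set
  IsClique S = ∀ x y → x ∈ S → y ∈ S → x ≢ y → x ∼ y

  IsMaximalClique : Subset n → Set
  IsMaximalClique S = IsClique S × (∀ T → S ⊂ T → ¬ IsClique T)

  IsBiconnected : Subset n → Set
  IsBiconnected B = (∃[ x ] x ∈ B) × ConnectedIn B × (∀ x → x ∈ B → ConnectedIn (B - x))

  IsBlock : Subset n → Set
  IsBlock B = IsBiconnected B × (∀ T → B ⊂ T → ¬ IsBiconnected T)

  IsBlockGraph : Set
  IsBlockGraph = Connected × (∀ B → IsBlock B → IsClique B)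

  Simplicial : Fin n → Set
  Simplicial v = ∀ x y → x ∼ v → y ∼ v → x ≢ y → x ∼ y

  IsSimplicialClique : Subset n → Set
  IsSimplicialClique Q = IsMaximalClique Q × (∃[ v ] (v ∈ Q × Simplicial v))

  IsBoundaryClique : Subset n → Set
  IsBoundaryClique Q = IsSimplicialClique Q ×
    (∃[ Q' ] (IsMaximalClique Q' ×
       (∀ x → (x ∈ Q ∩ Q' → (x ∈ Q × ¬ Simplicial x)) ×
              ((x ∈ Q × ¬ Simplicial x) → x ∈ Q ∩ Q'))))

  IsSeparator : Fin n → Fin n → Subset n → Set
  IsSeparator u v S = u ∉ S × v ∉ S × ¬ PathIn (∁ S) u v

  IsMinimalSeparator : Fin n → Fin n → Subset n → Set
  IsMinimalSeparator u v S = IsSeparator u v S × (∀ T → T ⊂ S → ¬ IsSeparator u v T)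

  IsMinimalVertexSeparator : Subset n → Set
  IsMinimalVertexSeparator S =
    ∃[ u ] ∃[ v ] (u ≢ v × ¬ (u ∼ v) × IsMinimalSeparator u v S)

-- G is strictly chordal (a block duplicate graph): G arises from a block graph H
-- by replacing each vertex a of H by a nonempty set f⁻¹(a) of pairwise true twins.
IsStrictlyChordal : ∀ {n} → Graph n → Set₁
IsStrictlyChordal {n} G =
  Σ ℕ λ m → Σ (Graph m) λ H → Σ (Fin n → Fin m) λ f →
    IsBlockGraph H ×
    (∀ a → ∃[ x ] f x ≡ a) ×
    (∀ x y → (_~_ G x y → (x ≢ y × (f x ≡ f y ⊎' _~_ H (f x) (f y)))) ×
             ((x ≢ y × (f x ≡ f y ⊎' _~_ H (f x) (f y))) → _~_ G x y))
  where open import Data.Sum using () renaming (_⊎_ to _⊎'_)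

module Submission where

-- Let Q be a boundary clique, Q' the maximal clique with Q ∩ Q' the non-simplicial part of Q,
-- y ∈ Q simplicial and z ∈ Q' ∖ Q. A path leaving Q has to leave through Q ∩ Q', since the
-- neighbours of a simplicial vertex of a maximal clique lie in that clique; every vertex of
-- Q ∩ Q' is adjacent to y and z, so Q ∩ Q' is a minimal yz-separator. Conversely a minimal
-- separator S' contains no simplicial vertex (a path can go around one), so S' ⊆ Q forces
-- S' ⊆ Q ∩ Q'. If some x ∈ Q ∩ Q' were missing from S', then x, y, z lie in one component of
-- G − S', while some s ∈ S' has a neighbour d in another component; d, s, x, y, z induce a
-- dart. A strictly chordal graph is dart-free: distinguishing s from x, y, z by d, a dart
-- maps to a diamond in the underlying block graph, whose four vertices lie in one block.

open import Defs hiding (sym)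
open import Data.Nat using (ℕ; zero; suc; _+_; _≤_)
open import Data.Nat.Properties using (≤-trans; ≤-reflexive; +-suc; +-monoˡ-≤; <-≤-trans; <-irrefl; +-identityʳ; m≤n+m)
open import Data.Fin using (Fin)
open import Data.Fin.Properties using (any?) renaming (_≟_ to _≟F_)
open import Data.Fin.Subset using (Subset; _∈_; _∉_; _⊆_; _⊂_; ∁; _∩_; _∪_; _─_; _-_; ⁅_⁆; ∣_∣; ⊤; inside; outside)
open import Data.Fin.Subset.Properties
  using (_∈?_; ∈⊤; x∈⁅x⁆; x∈⁅y⁆⇒x≡y; ⊆-antisym; p⊂q⇒∣p∣<∣q∣; ∣p∣≤n; x∈∁p⇒x∉p; x∉p⇒x∈∁p;
         x∈p∩q⁺; x∈p∩q⁻; p∩q⊆p; p⊆p∪q; x∈p∪q⁺; x∈p∪q⁻; p─q⊆p; x∈p∧x≢y⇒x∈p-y; x∈p⇒p-x⊂p)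
open import Data.Vec using (_∷_; here; there)
open import Data.Product using (∃-syntax; _×_; _,_; proj₁; proj₂)
open import Data.Sum using (_⊎_; inj₁; inj₂; map₁)
open import Data.Empty using (⊥; ⊥-elim)
open import Function using (_∘_)
open import Relation.Nullary using (¬_; yes; no)
open import Relation.Nullary.Decidable using (decidable-stable; ¬¬-excluded-middle; _×-dec_; ¬?)
open import Relation.Binary.PropositionalEquality using (_≡_; _≢_; refl; sym; trans; subst)

x∈p─q⇒x∉q : ∀ {k} (p q : Subset k) {x} → x ∈ p ─ q → x ∉ q
x∈p─q⇒x∉q (inside ∷ p) (outside ∷ q) here ()
x∈p─q⇒x∉q (_ ∷ p) (_ ∷ q) (there x∈p─q) (there x∈q) = x∈p─q⇒x∉q p q x∈p─q x∈q

x∈p-y⇒x∈p : ∀ {k} (p : Subset k) {x y} → x ∈ p - y → x ∈ p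
x∈p-y⇒x∈p p {y = y} = p─q⊆p p ⁅ y ⁆

x∈p-y⇒x≢y : ∀ {k} (p : Subset k) {x y} → x ∈ p - y → x ≢ y
x∈p-y⇒x≢y p {y = y} x∈p-y refl = x∈p─q⇒x∉q p ⁅ y ⁆ x∈p-y (x∈⁅x⁆ y)

x∈⁅y⁆∪p⁻ : ∀ {k} {x y : Fin k} (p : Subset k) → x ∈ ⁅ y ⁆ ∪ p → x ≡ y ⊎ x ∈ p
x∈⁅y⁆∪p⁻ {y = y} p = map₁ (x∈⁅y⁆⇒x≡y y) ∘ x∈p∪q⁻ ⁅ y ⁆ p

module _ {n : ℕ} (G : Graph n) where

  private
    _∼_ : Fin n → Fin n → Set
    x ∼ y = _~_ G x y

    ∼-sym : ∀ {x y} → x ∼ y → y ∼ x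
    ∼-sym = Graph.sym G

    ∼-irrefl : ∀ {x} → ¬ (x ∼ x)
    ∼-irrefl = Graph.irrefl G

  Apart : Fin n → Fin n → Set
  Apart a b = a ≢ b × ¬ (a ∼ b)

  apart-sym : ∀ {a b} → Apart a b → Apart b a
  apart-sym (a≢b , a≁b) = a≢b ∘ sym , a≁b ∘ ∼-sym

  -- The dart is K₄ on s, x, y, z minus the edge yz, with a pendant vertex d attached to s.
  DartFree : Set
  DartFree = ∀ {d s x y z} → d ∼ s → s ∼ x → s ∼ y → s ∼ z → x ∼ y → x ∼ z →
             Apart y z → Apart d x → Apart d y → Apart d z → ⊥

  source∈ : ∀ {S u v} → PathIn G S u v → u ∈ S
  source∈ (here u∈S) = u∈S
  source∈ (step u∈S _ _) = u∈S

  target∈ : ∀ {S u v} → PathIn G S u v → v ∈ S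
  target∈ (here v∈S) = v∈S
  target∈ (step _ _ p) = target∈ p

  infixr 5 _++ₚ_
  _++ₚ_ : ∀ {S u v w} → PathIn G S u v → PathIn G S v w → PathIn G S u w
  here _ ++ₚ q = q
  step u∈S uv p ++ₚ q = step u∈S uv (p ++ₚ q)

  reverse : ∀ {S u v} → PathIn G S u v → PathIn G S v u
  reverse (here u∈S) = here u∈S
  reverse (step u∈S uv p) = reverse p ++ₚ step (source∈ p) (∼-sym uv) (here u∈S)

  exitingEdge : ∀ {A S a t} → PathIn G A a t → a ∉ S → ¬ PathIn G (∁ S) a t →
                ∃[ d ] ∃[ s ] (PathIn G (∁ S) a d × d ∼ s × s ∈ S)
  exitingEdge (here _) a∉S noPath = ⊥-elim (noPath (here (x∉p⇒x∈∁p a∉S)))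
  exitingEdge {S = S} (step {v = v} _ av p) a∉S noPath with v ∈? S
  ... | yes v∈S = _ , v , here (x∉p⇒x∈∁p a∉S) , av , v∈S
  ... | no v∉S with exitingEdge p v∉S (noPath ∘ step (x∉p⇒x∈∁p a∉S) av)
  ...   | d , s , vd , ds , s∈S = d , s , step (x∉p⇒x∈∁p a∉S) av vd , ds , s∈S

  unreachable⇒apart : ∀ {S d x y} → d ∉ S → ¬ PathIn G (∁ S) d x → PathIn G (∁ S) y x → Apart d y
  unreachable⇒apart d∉S noPath yx = (λ { refl → noPath yx }) , λ dy → noPath (step (x∉p⇒x∈∁p d∉S) dy yx)

  separator-exitingEdge : ∀ {u v S x} → Connected G → IsSeparator G u v S → x ∉ S →
    ¬ ¬ (∃[ d ] ∃[ s ] (d ∉ S × d ∼ s × s ∈ S × ¬ PathIn G (∁ S) d x))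
  separator-exitingEdge {u} {v} {S} {x} connected (u∉S , v∉S , noUV) x∉S found =
    ¬¬-excluded-middle {A = PathIn G (∁ S) u x} λ where
      (yes ux) → found (exitFrom v∉S (λ vx → noUV (ux ++ₚ reverse vx)) (noUV ∘ reverse) (connected v u))
      (no ¬ux) → found (exitFrom u∉S ¬ux noUV (connected u v))
    where
      exitFrom : ∀ {w t} → w ∉ S → ¬ PathIn G (∁ S) w x → ¬ PathIn G (∁ S) w t → PathIn G ⊤ w t →
                 ∃[ d ] ∃[ s ] (d ∉ S × d ∼ s × s ∈ S × ¬ PathIn G (∁ S) d x)
      exitFrom w∉S ¬wx ¬wt wt with exitingEdge wt w∉S ¬wt
      ... | d , s , wd , ds , s∈S = d , s , x∈∁p⇒x∉p (target∈ wd) , ds , s∈S , λ dx → ¬wx (wd ++ₚ dx)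

  star⇒connectedIn : ∀ {T} h → h ∈ T → (∀ {u} → u ∈ T → u ≡ h ⊎ u ∼ h) → ConnectedIn G T
  star⇒connectedIn {T} h h∈T toCentre u v u∈T v∈T = spoke u∈T ++ₚ reverse (spoke v∈T)
    where
      spoke : ∀ {w} → w ∈ T → PathIn G T w h
      spoke {w} w∈T with toCentre w∈T
      ... | inj₁ refl = here w∈T
      ... | inj₂ wh = step w∈T wh (here h∈T)

  edgeDominated⇒biconnected : ∀ {T a b} → a ∈ T → b ∈ T → a ∼ b →
    (∀ {u} → u ∈ T → u ≡ a ⊎ u ≡ b ⊎ (u ∼ a × u ∼ b)) → IsBiconnected G T
  edgeDominated⇒biconnected {T} {a} {b} a∈T b∈T ab dominated =
    (a , a∈T) , star⇒connectedIn a a∈T toA , connectedWithout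
    where
      toA : ∀ {u} → u ∈ T → u ≡ a ⊎ u ∼ a
      toA u∈T with dominated u∈T
      ... | inj₁ u≡a = inj₁ u≡a
      ... | inj₂ (inj₁ refl) = inj₂ (∼-sym ab)
      ... | inj₂ (inj₂ (ua , _)) = inj₂ ua

      toB : ∀ {u} → u ∈ T → u ≢ a → u ≡ b ⊎ u ∼ b
      toB u∈T u≢a with dominated u∈T
      ... | inj₁ u≡a = ⊥-elim (u≢a u≡a)
      ... | inj₂ (inj₁ u≡b) = inj₁ u≡b
      ... | inj₂ (inj₂ (_ , ub)) = inj₂ ub

      connectedWithout : ∀ x → x ∈ T → ConnectedIn G (T - x)
      connectedWithout x _ with x ≟F a
      ... | yes refl = star⇒connectedIn b (x∈p∧x≢y⇒x∈p-y b∈T λ { refl → ∼-irrefl ab })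
                         (λ u∈ → toB (x∈p-y⇒x∈p T u∈) (x∈p-y⇒x≢y T u∈))
      ... | no x≢a = star⇒connectedIn a (x∈p∧x≢y⇒x∈p-y a∈T (x≢a ∘ sym))
                       (λ u∈ → toA (x∈p-y⇒x∈p T u∈))

  -- Enlarge X while possible; the budget k bounds how often X can still grow.
  private
    growToBlock : ∀ k {X} → n ≤ ∣ X ∣ + k → IsBiconnected G X → ¬ ¬ (∃[ B ] (IsBlock G B × X ⊆ B))
    growToBlock k {X} budget biconnectedX noBlock =
      ¬¬-excluded-middle {A = ∃[ T ] (X ⊂ T × IsBiconnected G T)} λ where
        (no maximal) → noBlock (X , (biconnectedX , λ T X⊂T bT → maximal (T , X⊂T , bT)) , λ x∈X → x∈X)
        (yes (T , X⊂T , bT)) → grow k budget X⊂T bT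
      where
        grow : ∀ j {T} → n ≤ ∣ X ∣ + j → X ⊂ T → IsBiconnected G T → ⊥
        grow zero {T} bound X⊂T _ = <-irrefl (sym (+-identityʳ ∣ X ∣))
          (<-≤-trans (p⊂q⇒∣p∣<∣q∣ X⊂T) (≤-trans (∣p∣≤n T) bound))
        grow (suc j) {T} bound X⊂T bT =
          growToBlock j (≤-trans bound (≤-trans (≤-reflexive (+-suc ∣ X ∣ j)) (+-monoˡ-≤ j (p⊂q⇒∣p∣<∣q∣ X⊂T)))) bT
            λ (B , blockB , T⊆B) → noBlock (B , blockB , T⊆B ∘ proj₁ X⊂T)

  biconnected⊆block : ∀ {X} → IsBiconnected G X → ¬ ¬ (∃[ B ] (IsBlock G B × X ⊆ B))
  biconnected⊆block {X} = growToBlock n (m≤n+m n ∣ X ∣)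

  diamondFree : (∀ B → IsBlock G B → IsClique G B) →
    ∀ {a b c e} → a ∼ b → a ∼ c → a ∼ e → b ∼ c → b ∼ e → c ≢ e → ¬ ¬ (c ∼ e)
  diamondFree blocksAreCliques {a} {b} {c} {e} ab ac ae bc be c≢e c≁e =
    biconnected⊆block (edgeDominated⇒biconnected a∈D b∈D ab dominated) λ (B , blockB , D⊆B) →
      c≁e (blocksAreCliques B blockB c e (D⊆B c∈D) (D⊆B e∈D) c≢e)
    where
      D : Subset n
      D = ⁅ a ⁆ ∪ ⁅ b ⁆ ∪ ⁅ c ⁆ ∪ ⁅ e ⁆

      a∈D : a ∈ D
      a∈D = x∈p∪q⁺ (inj₁ (x∈⁅x⁆ a))
      b∈D : b ∈ D
      b∈D = x∈p∪q⁺ (inj₂ (x∈p∪q⁺ (inj₁ (x∈⁅x⁆ b))))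
      c∈D : c ∈ D
      c∈D = x∈p∪q⁺ (inj₂ (x∈p∪q⁺ (inj₂ (x∈p∪q⁺ (inj₁ (x∈⁅x⁆ c))))))
      e∈D : e ∈ D
      e∈D = x∈p∪q⁺ (inj₂ (x∈p∪q⁺ (inj₂ (x∈p∪q⁺ (inj₂ (x∈⁅x⁆ e))))))

      dominated : ∀ {u} → u ∈ D → u ≡ a ⊎ u ≡ b ⊎ (u ∼ a × u ∼ b)
      dominated u∈D with x∈⁅y⁆∪p⁻ _ u∈D
      ... | inj₁ u≡a = inj₁ u≡a
      ... | inj₂ u∈bce with x∈⁅y⁆∪p⁻ _ u∈bce
      ... | inj₁ u≡b = inj₂ (inj₁ u≡b)
      ... | inj₂ u∈ce with x∈⁅y⁆∪p⁻ _ u∈ce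
      ... | inj₁ refl = inj₂ (inj₂ (∼-sym ac , ∼-sym bc))
      ... | inj₂ u∈e rewrite x∈⁅y⁆⇒x≡y e u∈e = inj₂ (inj₂ (∼-sym ae , ∼-sym be))

  ∪⁅⁆-isClique : ∀ {Q v} → IsClique G Q → (∀ {x} → x ∈ Q → x ∼ v) → IsClique G (Q ∪ ⁅ v ⁆)
  ∪⁅⁆-isClique {Q} {v} cliqueQ toV a b a∈ b∈ a≢b with x∈p∪q⁻ Q ⁅ v ⁆ a∈ | x∈p∪q⁻ Q ⁅ v ⁆ b∈
  ... | inj₁ a∈Q | inj₁ b∈Q = cliqueQ a b a∈Q b∈Q a≢b
  ... | inj₁ a∈Q | inj₂ b∈v rewrite x∈⁅y⁆⇒x≡y v b∈v = toV a∈Q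
  ... | inj₂ a∈v | inj₁ b∈Q rewrite x∈⁅y⁆⇒x≡y v a∈v = ∼-sym (toV b∈Q)
  ... | inj₂ a∈v | inj₂ b∈v = ⊥-elim (a≢b (trans (x∈⁅y⁆⇒x≡y v a∈v) (sym (x∈⁅y⁆⇒x≡y v b∈v))))

  simplicial-neighbours : ∀ {s w x} → Simplicial G s → w ∼ s → x ∼ s → w ≡ x ⊎ w ∼ x
  simplicial-neighbours {w = w} {x} simplicial ws xs with w ≟F x
  ... | yes w≡x = inj₁ w≡x
  ... | no w≢x = inj₂ (simplicial w x ws xs w≢x)

  simplicial-neighbour∈maximalClique : ∀ {Q w v} → IsMaximalClique G Q → w ∈ Q → Simplicial G w → v ∼ w → v ∈ Q
  simplicial-neighbour∈maximalClique {Q} {w} {v} (cliqueQ , maximal) w∈Q simplicial vw =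
    decidable-stable (v ∈? Q) λ v∉Q →
      maximal (Q ∪ ⁅ v ⁆) (p⊆p∪q ⁅ v ⁆ , v , x∈p∪q⁺ (inj₂ (x∈⁅x⁆ v)) , v∉Q) (∪⁅⁆-isClique cliqueQ (toV v∉Q))
    where
      toV : v ∉ Q → ∀ {x} → x ∈ Q → x ∼ v
      toV v∉Q {x} x∈Q with x ≟F w
      ... | yes refl = ∼-sym vw
      ... | no x≢w = simplicial x v (cliqueQ x w x∈Q w∈Q x≢w) vw λ { refl → v∉Q x∈Q }

  maximalClique⊈clique : ∀ {Q Q' y} → IsMaximalClique G Q' → IsClique G Q → y ∈ Q → y ∉ Q' →
    ∃[ z ] (z ∈ Q' × z ∉ Q)
  maximalClique⊈clique {Q} {Q'} {y} (_ , maximal) cliqueQ y∈Q y∉Q'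
    with any? (λ x → (x ∈? Q') ×-dec ¬? (x ∈? Q))
  ... | yes found = found
  ... | no none = ⊥-elim (maximal Q (Q'⊆Q , y , y∈Q , y∉Q') cliqueQ)
    where
      Q'⊆Q : Q' ⊆ Q
      Q'⊆Q {x} x∈Q' = decidable-stable (x ∈? Q) λ x∉Q → none (x , x∈Q' , x∉Q)

  -- Going around s: w tracks the current vertex of the new path, equal or adjacent to the
  -- current vertex of the old one; two neighbours of the simplicial s are equal or adjacent.
  simplicial∉minimalSeparator : ∀ {u v S s} → IsMinimalSeparator G u v S → s ∈ S → ¬ Simplicial G s
  simplicial∉minimalSeparator {u} {v} {S} {s} ((u∉S , v∉S , noPath) , minimal) s∈S simplicial =
    minimal (S - s) (x∈p⇒p-x⊂p s∈S)
      (u∉S ∘ x∈p-y⇒x∈p S , v∉S ∘ x∈p-y⇒x∈p S , λ p → noPath (bypass p u∉S (inj₁ refl)))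
    where
      bypass : ∀ {x w} → PathIn G (∁ (S - s)) x v → w ∉ S → w ≡ x ⊎ w ∼ x → PathIn G (∁ S) w v
      bypass (here _) w∉S (inj₁ refl) = here (x∉p⇒x∈∁p w∉S)
      bypass (here _) w∉S (inj₂ wv) = step (x∉p⇒x∈∁p w∉S) wv (here (x∉p⇒x∈∁p v∉S))
      bypass (step _ xx' p) w∉S (inj₁ refl) = bypass p w∉S (inj₂ xx')
      bypass (step {u = x} x∈ xx' p) w∉S (inj₂ wx) with x ≟F s
      ... | yes refl = bypass p w∉S (simplicial-neighbours simplicial wx (∼-sym xx'))
      ... | no x≢s = step (x∉p⇒x∈∁p w∉S) wx (bypass p x∉S (inj₂ xx'))
        where
          x∉S : x ∉ S
          x∉S x∈S = x∈∁p⇒x∉p x∈ (x∈p∧x≢y⇒x∈p-y x∈S x≢s)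

  avoidingPath-staysInClique : ∀ {Q S} → IsMaximalClique G Q →
    (∀ {x} → x ∈ Q → x ∉ S → ¬ ¬ Simplicial G x) →
    ∀ {w t} → PathIn G (∁ S) w t → w ∈ Q → t ∈ Q
  avoidingPath-staysInClique maxQ outsideSimplicial (here _) w∈Q = w∈Q
  avoidingPath-staysInClique {Q} maxQ outsideSimplicial (step {v = v} w∈∁S wv p) w∈Q =
    avoidingPath-staysInClique maxQ outsideSimplicial p
      (decidable-stable (v ∈? Q) λ v∉Q → outsideSimplicial w∈Q (x∈∁p⇒x∉p w∈∁S) λ simplicial →
        v∉Q (simplicial-neighbour∈maximalClique maxQ w∈Q simplicial (∼-sym wv)))

  commonNeighbours⇒minimalSeparator : ∀ {y z S} → IsSeparator G y z S →
    (∀ {x} → x ∈ S → x ∼ y × x ∼ z) → IsMinimalSeparator G y z S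
  commonNeighbours⇒minimalSeparator separator common =
    separator , λ T (_ , x , x∈S , x∉T) (y∉T , z∉T , noPath) →
      noPath (step (x∉p⇒x∈∁p y∉T) (∼-sym (proj₁ (common x∈S)))
             (step (x∉p⇒x∈∁p x∉T) (proj₂ (common x∈S)) (here (x∉p⇒x∈∁p z∉T))))

  -- A vertex x ∈ S ∖ S' and an edge ds leaving the component of x in G − S' span a dart with y, z.
  clique⊆separator : ∀ {S S' u v y z} → Connected G → DartFree → IsClique G S →
    (∀ {x} → x ∈ S → x ∼ y × x ∼ z) → Apart y z → IsSeparator G u v S' → S' ⊆ S → S ⊆ S'
  clique⊆separator {S} {S'} {y = y} {z} connected dartFree cliqueS common yz separator S'⊆S {x} x∈S =
    decidable-stable (x ∈? S') λ x∉S' → separator-exitingEdge connected separator x∉S'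
      λ (d , s , d∉S' , ds , s∈S' , ¬dx) →
        let s∈S = S'⊆S s∈S'
            reaches : ∀ {w} → w ∉ S' → w ∼ x → PathIn G (∁ S') w x
            reaches w∉S' wx = step (x∉p⇒x∈∁p w∉S') wx (here (x∉p⇒x∈∁p x∉S'))
            xy = proj₁ (common x∈S)
            xz = proj₂ (common x∈S)
        in dartFree ds (cliqueS s x s∈S x∈S λ { refl → x∉S' s∈S' })
             (proj₁ (common s∈S)) (proj₂ (common s∈S)) xy xz yz
             (unreachable⇒apart d∉S' ¬dx (here (x∉p⇒x∈∁p x∉S')))
             (unreachable⇒apart d∉S' ¬dx (reaches y∉S' (∼-sym xy)))
             (unreachable⇒apart d∉S' ¬dx (reaches z∉S' (∼-sym xz)))
    where
      y∉S' : y ∉ S'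
      y∉S' y∈S' = ∼-irrefl (proj₁ (common (S'⊆S y∈S')))
      z∉S' : z ∉ S'
      z∉S' z∈S' = ∼-irrefl (proj₂ (common (S'⊆S z∈S')))

module TwinExpansion {n m : ℕ} {G : Graph n} {H : Graph m} {f : Fin n → Fin m}
  (expands : ∀ x y → (_~_ G x y → (x ≢ y × (f x ≡ f y ⊎ _~_ H (f x) (f y)))) ×
                     ((x ≢ y × (f x ≡ f y ⊎ _~_ H (f x) (f y))) → _~_ G x y)) where

  private
    _∼_ : Fin n → Fin n → Set
    x ∼ y = _~_ G x y

    _≈_ : Fin m → Fin m → Set
    a ≈ b = _~_ H a b

  ∼-intro : ∀ {x y} → x ≢ y → f x ≡ f y ⊎ f x ≈ f y → x ∼ y
  ∼-intro x≢y related = proj₂ (expands _ _) (x≢y , related)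

  ∼⇒≈ : ∀ {x y} → x ∼ y → f x ≢ f y → f x ≈ f y
  ∼⇒≈ {x} {y} xy fx≢fy with proj₂ (proj₁ (expands x y) xy)
  ... | inj₁ fx≡fy = ⊥-elim (fx≢fy fx≡fy)
  ... | inj₂ fx≈fy = fx≈fy

  twin-∼ : ∀ {a b c} → f a ≡ f b → c ∼ a → c ≢ b → c ∼ b
  twin-∼ {a} {b} {c} fa≡fb ca c≢b with proj₂ (proj₁ (expands c a) ca)
  ... | inj₁ fc≡fa = ∼-intro c≢b (inj₁ (trans fc≡fa fa≡fb))
  ... | inj₂ fc≈fa = ∼-intro c≢b (inj₂ (subst (f c ≈_) fa≡fb fc≈fa))

  ∼-apart⇒≢ : ∀ {a b c} → c ∼ a → Apart G c b → f a ≢ f b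
  ∼-apart⇒≢ ca (c≢b , c≁b) fa≡fb = c≁b (twin-∼ fa≡fb ca c≢b)

  expansion-connected : (∀ a → ∃[ x ] f x ≡ a) → Connected H → Connected G
  expansion-connected surjective connectedH u v = lift (connectedH (f u) (f v)) refl refl
    where
      lift : ∀ {a b u v} → PathIn H ⊤ a b → f u ≡ a → f v ≡ b → PathIn G ⊤ u v
      lift {u = u} {v} (here _) refl fv≡fu with u ≟F v
      ... | yes refl = here ∈⊤
      ... | no u≢v = step ∈⊤ (∼-intro u≢v (inj₁ (sym fv≡fu))) (here ∈⊤)
      lift {u = u} (step {v = a'} _ fu≈a' p) refl fv≡b with surjective a'
      ... | u' , refl = step ∈⊤ (∼-intro u≢u' (inj₂ fu≈a')) (lift p refl fv≡b)
        where
          u≢u' : u ≢ u'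
          u≢u' refl = Graph.irrefl H fu≈a'

  -- d tells s apart from x, y and z, so the images of the dart contain a diamond of H.
  expansion-dartFree : (∀ B → IsBlock H B → IsClique H B) → DartFree G
  expansion-dartFree blocksAreCliques ds sx sy sz xy xz yz dx dy dz =
    diamondFree H blocksAreCliques
      (∼⇒≈ sx (∼-apart⇒≢ ds dx)) (∼⇒≈ sy (∼-apart⇒≢ ds dy)) (∼⇒≈ sz (∼-apart⇒≢ ds dz))
      (∼⇒≈ xy (∼-apart⇒≢ (Graph.sym G xz) (apart-sym G yz))) (∼⇒≈ xz (∼-apart⇒≢ (Graph.sym G xy) yz))
      (λ fy≡fz → proj₂ yz (∼-intro (proj₁ yz) (inj₁ fy≡fz)))
      (λ fy≈fz → proj₂ yz (∼-intro (proj₁ yz) (inj₂ fy≈fz)))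

module BoundaryClique {n : ℕ} (G : Graph n) {Q Q' : Subset n}
  (maxQ : IsMaximalClique G Q) (maxQ' : IsMaximalClique G Q')
  (interface : ∀ x → (x ∈ Q ∩ Q' → (x ∈ Q × ¬ Simplicial G x)) × ((x ∈ Q × ¬ Simplicial G x) → x ∈ Q ∩ Q'))
  {y : Fin n} (y∈Q : y ∈ Q) (ySimplicial : Simplicial G y) where

  private
    _∼_ : Fin n → Fin n → Set
    x ∼ y = _~_ G x y

  ∩-nonSimplicial : ∀ {x} → x ∈ Q ∩ Q' → ¬ Simplicial G x
  ∩-nonSimplicial {x} = proj₂ ∘ proj₁ (interface x)

  ∖∩-simplicial : ∀ {x} → x ∈ Q → x ∉ Q ∩ Q' → ¬ ¬ Simplicial G x
  ∖∩-simplicial {x} x∈Q x∉Q∩Q' nonSimplicial = x∉Q∩Q' (proj₂ (interface x) (x∈Q , nonSimplicial))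

  ∩-isClique : IsClique G (Q ∩ Q')
  ∩-isClique a b a∈ b∈ = proj₁ maxQ a b (p∩q⊆p Q Q' a∈) (p∩q⊆p Q Q' b∈)

  private
    y∉Q∩Q' : y ∉ Q ∩ Q'
    y∉Q∩Q' y∈Q∩Q' = ∩-nonSimplicial y∈Q∩Q' ySimplicial

    outsider : ∃[ z ] (z ∈ Q' × z ∉ Q)
    outsider = maximalClique⊈clique G maxQ' (proj₁ maxQ) y∈Q
                 (λ y∈Q' → y∉Q∩Q' (x∈p∩q⁺ (y∈Q , y∈Q')))

    z = proj₁ outsider
    z∈Q' = proj₁ (proj₂ outsider)
    z∉Q = proj₂ (proj₂ outsider)

  ∩-commonNeighbours : ∀ {x} → x ∈ Q ∩ Q' → x ∼ y × x ∼ z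
  ∩-commonNeighbours {x} x∈Q∩Q' with x∈p∩q⁻ Q Q' x∈Q∩Q'
  ... | x∈Q , x∈Q' = proj₁ maxQ x y x∈Q y∈Q (λ { refl → y∉Q∩Q' x∈Q∩Q' })
                   , proj₁ maxQ' x z x∈Q' z∈Q' (λ { refl → z∉Q x∈Q })

  y-apart-z : Apart G y z
  y-apart-z = (λ y≡z → z∉Q (subst (_∈ Q) y≡z y∈Q))
            , λ yz → z∉Q (simplicial-neighbour∈maximalClique G maxQ y∈Q ySimplicial (Graph.sym G yz))

  ∩-minimalVertexSeparator : IsMinimalVertexSeparator G (Q ∩ Q')
  ∩-minimalVertexSeparator = y , z , proj₁ y-apart-z , proj₂ y-apart-z ,
    commonNeighbours⇒minimalSeparator G
      (y∉Q∩Q' , z∉Q ∘ p∩q⊆p Q Q' , λ p → z∉Q (avoidingPath-staysInClique G maxQ ∖∩-simplicial p y∈Q))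
      ∩-commonNeighbours

  minimalVertexSeparator⊆∩ : ∀ {S} → S ⊆ Q → IsMinimalVertexSeparator G S → S ⊆ Q ∩ Q'
  minimalVertexSeparator⊆∩ S⊆Q (_ , _ , _ , _ , minimal) {s} s∈S =
    decidable-stable (s ∈? Q ∩ Q') λ s∉Q∩Q' →
      ∖∩-simplicial (S⊆Q s∈S) s∉Q∩Q' (simplicial∉minimalSeparator G minimal s∈S)

  ∩⊆minimalVertexSeparator : ∀ {S} → Connected G → DartFree G → S ⊆ Q → IsMinimalVertexSeparator G S →
    Q ∩ Q' ⊆ S
  ∩⊆minimalVertexSeparator connected dartFree S⊆Q minimalS@(_ , _ , _ , _ , minimal) =
    clique⊆separator G connected dartFree ∩-isClique ∩-commonNeighbours y-apart-z
      (proj₁ minimal) (minimalVertexSeparator⊆∩ S⊆Q minimalS)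

mainTheorem1 : ∀ {n : ℕ} (G : Graph n) → IsStrictlyChordal G →
    ∀ (Q : Subset n) → IsBoundaryClique G Q →
    ∃[ S ] ((S ⊆ Q × IsMinimalVertexSeparator G S) ×
            (∀ S' → S' ⊆ Q → IsMinimalVertexSeparator G S' → S' ≡ S))
mainTheorem1 G (_ , H , f , (connectedH , blocksAreCliques) , surjective , expands) Q
             ((maxQ , _ , y∈Q , ySimplicial) , Q' , maxQ' , interface) =
  Q ∩ Q' , (p∩q⊆p Q Q' , ∩-minimalVertexSeparator) ,
  λ S' S'⊆Q minimalS' → ⊆-antisym (minimalVertexSeparator⊆∩ S'⊆Q minimalS')
    (∩⊆minimalVertexSeparator (expansion-connected surjective connectedH)
                              (expansion-dartFree blocksAreCliques) S'⊆Q minimalS')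
  where
    open BoundaryClique G maxQ maxQ' interface y∈Q ySimplicial
    open TwinExpansion {G = G} {H = H} {f = f} expands
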